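{- $1\mathrm{SP}\subsetneqq \mathrm{co}\text{ - }1\mathrm{C}_{=}$ and $1\mathrm{SP}\subsetneqq 1\mathrm{C}_{=}$.
   Context: A one-way nondeterministic finite automaton (1nfa) is $M=(Q,\Sigma,\{\rhd,\lhd\},\delta,q_0,Q_{acc},Q_{rej})$: finite state set $Q$, input alphabet $\Sigma$, endmarkers $\rhd,\lhd\notin\Sigma$, disjoint sets $Q_{acc},Q_{rej}\subseteq Q$ ($Q_{halt}=Q_{acc}\cup Q_{rej}$), transition function $\delta:(Q-Q_{halt})\times(\Sigma\cup\{\rhd,\lhd\})\to\mathcal P(Q)$. On input $x$ it reads $\rhd x\lhd$ left to right, moving its head one cell right at every step (no $\lambda$-moves), halting on entering a halting state. A path is accepting (resp. rejecting) if it enters $Q_{acc}$ (resp. $Q_{rej}$), otherwise neither. $\#M(x)$, $\#\overline{M}(x)$ are the numbers of accepting and rejecting paths on $x$. A family $\{M_n\}_{n\in\mathbb N}$ has polynomial size if $|Q_n|\le p(n)$ for a fixed polynomial $p$. A family of promise problems over a fixed alphabet $\Sigma$ is $\mathcal L=\{(L_n^{(+)},L_n^{(-)})\}_{n\in\mathbb N}$ with $L_n^{(+)},L_n^{(-)}\subseteq\Sigma^*$ disjoint; $\mathrm{co}\text{ - }\mathcal L=\{(L_n^{(-)},L_n^{(+)})\}_n$ and $\mathrm{co}\text{ - }\mathcal C=\{\mathrm{co}\text{ - }\mathcal L:\mathcal L\in\mathcal C\}$. A family of partial functions is $\{(f_n,D_n)\}_n$, $D_n\subseteq\Sigma^*$.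 $1\mathrm{Gap}$ is the class of such families for which a polynomial-size family of 1nfa's satisfies $f_n(x)=\#M_n(x)-\#\overline{M}_n(x)$ for all $n$, $x\in D_n$. $\mathcal L\in1\mathrm{SP}$ iff some $\{(f_n,D_n)\}\in1\mathrm{Gap}$ has $L_n^{(+)}\cup L_n^{(-)}\subseteq D_n$, $f_n=1$ on $L_n^{(+)}$ and $f_n=0$ on $L_n^{(-)}$ for all $n$; $\mathcal L\in1\mathrm C_{=}$ iff some $\{(f_n,D_n)\}\in1\mathrm{Gap}$ has $L_n^{(+)}\cup L_n^{(-)}\subseteq D_n$, $f_n=0$ on $L_n^{(+)}$ and $f_n\ne0$ on $L_n^{(-)}$ for all $n$. -}

module Defs where

open import Data.Nat using (ℕ; zero; suc; _+_; _*_; _≤_)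
open import Data.Nat.ListAction using (sum)
open import Data.Integer using (ℤ; +_; _-_)
open import Data.Fin using (Fin)
open import Data.Fin.Subset using (Subset)
open import Data.Vec using (lookup)
open import Data.List using (List; []; _∷_; map; _++_; allFin)
open import Data.Bool using (Bool; true; false; if_then_else_; _∨_)
open import Data.Product using (Σ; _×_)
open import Data.Empty using (⊥)
open import Relation.Binary.PropositionalEquality using (_≡_; _≢_)

data Sym (s : ℕ) : Set where
  ▷ ◁ : Sym s
  sym : Fin s → Sym s

tape : ∀ {s} → List (Fin s) → List (Sym s)
tape x = ▷ ∷ (map sym x ++ (◁ ∷ []))

-- One-way nondeterministic finite automata with state set Q = Fin states.
-- δ q a is a subset of Q (a member of 𝒫(Q)); its values on halting states
-- are irrelevant (never consulted), which models δ being defined only on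
-- Q - Q_halt.

record 1NFA (s : ℕ) : Set where
  field
    states   : ℕ
    δ        : Fin states → Sym s → Subset states
    q₀       : Fin states
    Qacc     : Subset states
    Qrej     : Subset states
    disjoint : ∀ q → lookup Qacc q ≡ true → lookup Qrej q ≡ true → ⊥

  halting : Fin states → Bool
  halting q = lookup Qacc q ∨ lookup Qrej q

  -- A path halts as soon as it enters a halting state; a path that
  -- moves off the tape (after reading ◁) without halting counts for neither.
  paths : Subset states → Fin states → List (Sym s) → ℕ
  paths target q w with lookup target q | halting q | w
  ... | true  | _     | _      = 1
  ... | false | true  | _      = 0
  ... | false | false | []     = 0
  ... | false | false | a ∷ w′ =
    sum (map (λ p → if lookup (δ q a) p then paths target p w′ else 0) (allFin states))

  #acc : List (Fin s) → ℕ
  #acc x = paths Qacc q₀ (tape x)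

  #rej : List (Fin s) → ℕ
  #rej x = paths Qrej q₀ (tape x)

  gap : List (Fin s) → ℤ
  gap x = + #acc x - + #rej x

open 1NFA public

Poly : Set
Poly = List ℕ

eval : Poly → ℕ → ℕ
eval []       n = 0
eval (c ∷ cs) n = c + n * eval cs n

PolySize : ∀ {s} → (ℕ → 1NFA s) → Set
PolySize M = Σ Poly λ p → ∀ n → states (M n) ≤ eval p n

record Promise (s : ℕ) : Set₁ where
  field
    pos  : ℕ → List (Fin s) → Set
    neg  : ℕ → List (Fin s) → Set
    disj : ∀ n x → pos n x → neg n x → ⊥

open Promise public

co : ∀ {s} → Promise s → Promise s
co L = record { pos = neg L ; neg = pos L ; disj = λ n x p q → disj L n x q p }

record PFam (s : ℕ) : Set₁ where
  field
    D : ℕ → List (Fin s) → Set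
    f : (n : ℕ) (x : List (Fin s)) → D n x → ℤ

open PFam public

In1Gap : ∀ {s} → PFam s → Set
In1Gap {s} F = Σ (ℕ → 1NFA s) λ M → PolySize M ×
  (∀ n x (d : D F n x) → f F n x d ≡ gap (M n) x)

In1SP : ∀ {s} → Promise s → Set₁
In1SP {s} L = Σ (PFam s) λ F → In1Gap F ×
  Σ (∀ n x → pos L n x → D F n x) λ sub⁺ →
  Σ (∀ n x → neg L n x → D F n x) λ sub⁻ →
    (∀ n x (h : pos L n x) → f F n x (sub⁺ n x h) ≡ + 1) ×
    (∀ n x (h : neg L n x) → f F n x (sub⁻ n x h) ≡ + 0)

In1C₌ : ∀ {s} → Promise s → Set₁
In1C₌ {s} L = Σ (PFam s) λ F → In1Gap F ×
  Σ (∀ n x → pos L n x → D F n x) λ sub⁺ →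
  Σ (∀ n x → neg L n x → D F n x) λ sub⁻ →
    (∀ n x (h : pos L n x) → f F n x (sub⁺ n x h) ≡ + 0) ×
    (∀ n x (h : neg L n x) → f F n x (sub⁻ n x h) ≢ + 0)

InCo1C₌ : ∀ {s} → Promise s → Set₁
InCo1C₌ L = In1C₌ (co L)

-- Inclusions: a 1SP gap function is 1 or 0 on the promise, so it witnesses co-1C₌ as it stands,
-- and 1C₌ after subtracting one, which a machine realises by adding a single rejecting path.
-- Separation: the machine that spawns an accepting path per a and a rejecting path per b has gap
-- #a − #b, so {aⁱbⁱ} against {aⁱbʲ : i ≠ j} is in 1C₌ (and its complement in co-1C₌). A 1SP
-- machine for either would make #acc + #rej odd on one side and even on the other. But path
-- counts evolve linearly, so the parity of #acc + #rej on uv depends on u only through finitely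
-- many bits (the parity of the paths already halted and of the number of paths in each state);
-- by pigeonhole two prefixes aⁱ and aʲ, i < j, agree on them, and the suffix bⁱ separates them.

module Submission where

open import Defs
open import Data.Nat using (ℕ; zero; suc; _+_; _*_; _≤_; _<_; _^_; s≤s; NonZero)
open import Data.Nat.Properties
  using ( +-*-semiring; +-commutativeSemigroup; +-comm; +-assoc; +-identityʳ
        ; *-comm; *-zeroʳ; *-identityˡ; *-assoc; *-distribˡ-+; <⇒≢; n<1+n; m≤m+n )
import Data.Nat.ListAction as List
open import Data.Nat.DivMod using (_%_; _mod_; %-distribˡ-+; %-distribˡ-*; [m+kn]%n≡m%n)
open import Data.Fin using (Fin; zero; suc; toℕ; funToFin; finToFun)
open import Data.Fin.Properties using (pigeonhole; finToFun-funToFin; toℕ-fromℕ<)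
open import Data.Fin.Subset using (Subset; ⁅_⁆) renaming (⊥ to ∅)
open import Data.Vec using (lookup; _∷_; [])
open import Data.Vec.Properties using (lookup-replicate)
open import Data.List using (List; []; _∷_; map; _++_; allFin; tabulate; replicate)
open import Data.List.Properties using (map-++; ++-assoc; map-tabulate)
open import Data.Bool using (Bool; true; false; if_then_else_)
open import Data.Bool.Properties using (∨-zeroʳ)
open import Data.Integer using (+_; -_; _-_; 0ℤ) renaming (_+_ to _+ℤ_)
import Data.Integer.Properties as ℤ
open import Data.Product using (Σ; _×_; _,_)
open import Data.Sum using (_⊎_; inj₁; inj₂)
open import Data.Unit using (⊤; tt)
open import Function using (_∘_)
open import Relation.Binary.PropositionalEquality renaming (sym to ≡-sym)
open import Relation.Nullary using (¬_; contradiction)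
open import Algebra.Properties.Semiring.Sum +-*-semiring
  using (sum; sum-syntax; sum-cong-≗; sum-replicate-zero; ∑-distrib-+; ∑-comm; *-distribˡ-sum; *-distribʳ-sum)
open import Algebra.Properties.CommutativeSemigroup +-commutativeSemigroup using (interchange)

open ≡-Reasoning

indicator : Bool → ℕ
indicator b = if b then 1 else 0

masked : ∀ {n} → Subset n → (Fin n → ℕ) → Fin n → ℕ
masked S g p = if lookup S p then g p else 0

masked≡indicator* : ∀ {n} (S : Subset n) g p → masked S g p ≡ indicator (lookup S p) * g p
masked≡indicator* S g p with lookup S p
... | true  = ≡-sym (+-identityʳ (g p))
... | false = refl

sum-tabulate : ∀ k (g : Fin k → ℕ) → List.sum (tabulate g) ≡ ∑[ i < k ] g i
sum-tabulate zero    g = refl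
sum-tabulate (suc k) g = cong (λ r → g zero + r) (sum-tabulate k (g ∘ suc))

sum-map-allFin : ∀ k (g : Fin k → ℕ) → List.sum (map g (allFin k)) ≡ ∑[ i < k ] g i
sum-map-allFin k g = trans (cong List.sum (map-tabulate (λ i → i) g)) (sum-tabulate k g)

∑-indicator-∅ : ∀ n (g : Fin n → ℕ) → ∑[ p < n ] (indicator (lookup ∅ p) * g p) ≡ 0
∑-indicator-∅ n g =
  trans (sum-cong-≗ λ p → cong (λ b → indicator b * g p) (lookup-replicate p false)) (sum-replicate-zero n)

∑-indicator-⁅⁆ : ∀ {n} (q : Fin n) (g : Fin n → ℕ) → ∑[ p < n ] (indicator (lookup ⁅ q ⁆ p) * g p) ≡ g q
∑-indicator-⁅⁆ {suc n} zero    g =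
  trans (cong₂ _+_ (*-identityˡ (g zero)) (∑-indicator-∅ n (g ∘ suc))) (+-identityʳ (g zero))
∑-indicator-⁅⁆ {suc n} (suc q) g = ∑-indicator-⁅⁆ q (g ∘ suc)

module Congruence (d : ℕ) .{{_ : NonZero d}} where

  infix 4 _≡ₘ_
  record _≡ₘ_ (m n : ℕ) : Set where
    constructor mod-≡
    field %-≡ : m % d ≡ n % d

  open _≡ₘ_ public

  +-cong : ∀ {m m′ n n′} → m ≡ₘ m′ → n ≡ₘ n′ → m + n ≡ₘ m′ + n′
  +-cong {m} {m′} {n} {n′} (mod-≡ m≡m′) (mod-≡ n≡n′) = mod-≡ (begin
    (m + n) % d            ≡⟨ %-distribˡ-+ m n d ⟩
    (m % d + n % d) % d    ≡⟨ cong₂ (λ x y → (x + y) % d) m≡m′ n≡n′ ⟩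
    (m′ % d + n′ % d) % d  ≡⟨ ≡-sym (%-distribˡ-+ m′ n′ d) ⟩
    (m′ + n′) % d          ∎)

  *-congʳ : ∀ {m m′} n → m ≡ₘ m′ → m * n ≡ₘ m′ * n
  *-congʳ {m} {m′} n (mod-≡ m≡m′) = mod-≡ (begin
    (m * n) % d            ≡⟨ %-distribˡ-* m n d ⟩
    (m % d * (n % d)) % d  ≡⟨ cong (λ x → (x * (n % d)) % d) m≡m′ ⟩
    (m′ % d * (n % d)) % d ≡⟨ ≡-sym (%-distribˡ-* m′ n d) ⟩
    (m′ * n) % d           ∎)

  sum-cong : ∀ {k} {f g : Fin k → ℕ} → (∀ i → f i ≡ₘ g i) → sum f ≡ₘ sum g
  sum-cong {zero}  f≡g = mod-≡ refl
  sum-cong {suc k} f≡g = +-cong (f≡g zero) (sum-cong (f≡g ∘ suc))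

  mod-injective : ∀ {m n} → m mod d ≡ n mod d → m ≡ₘ n
  mod-injective eq = mod-≡ (trans (≡-sym (toℕ-fromℕ< _)) (trans (cong toℕ eq) (toℕ-fromℕ< _)))

open Congruence 2

module Paths {s : ℕ} (M : 1NFA s) where

  HaltingSet : Subset (states M) → Set
  HaltingSet t = ∀ q → lookup t q ≡ true → halting M q ≡ true

  Qacc-halting : HaltingSet (Qacc M)
  Qacc-halting q q∈Qacc rewrite q∈Qacc = refl

  Qrej-halting : HaltingSet (Qrej M)
  Qrej-halting q q∈Qrej rewrite q∈Qrej = ∨-zeroʳ _

  paths-halting : ∀ t q w → halting M q ≡ true → paths M t q w ≡ indicator (lookup t q)
  paths-halting t q w hq with lookup t q | halting M q
  ... | true  | _    = refl
  ... | false | true = refl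

  move : Fin (states M) → Sym s → Fin (states M) → ℕ
  move q a p = if halting M q then 0 else indicator (lookup (δ M q a) p)

  paths-∷ : ∀ {t} → HaltingSet t → ∀ q a w →
    paths M t q (a ∷ w) ≡ indicator (lookup t q) + ∑[ p < states M ] (move q a p * paths M t p w)
  paths-∷ {t} t-halting q a w with lookup t q in q∈t | halting M q in hq
  ... | true  | true  = cong suc (≡-sym (sum-replicate-zero (states M)))
  ... | true  | false = contradiction (trans (≡-sym hq) (t-halting q q∈t)) λ ()
  ... | false | true  = ≡-sym (sum-replicate-zero (states M))
  ... | false | false = trans (sum-map-allFin (states M) _)
    (sum-cong-≗ (masked≡indicator* (δ M q a) λ p → paths M t p w))

  -- A weight vector counts the computation paths currently sitting in each state.
  Weights : Set
  Weights = Fin (states M) → ℕ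

  weighted : Subset (states M) → Weights → List (Sym s) → ℕ
  weighted t c w = ∑[ q < states M ] (c q * paths M t q w)

  hits : Subset (states M) → Weights → ℕ
  hits t c = ∑[ q < states M ] (c q * indicator (lookup t q))

  step : Weights → Sym s → Weights
  step c a p = ∑[ q < states M ] (c q * move q a p)

  weighted-∷ : ∀ {t} → HaltingSet t → ∀ c a w → weighted t c (a ∷ w) ≡ hits t c + weighted t (step c a) w
  weighted-∷ {t} t-halting c a w = begin
    ∑[ q < n ] (c q * paths M t q (a ∷ w))
      ≡⟨ sum-cong-≗ (λ q → cong (c q *_) (paths-∷ {t} t-halting q a w)) ⟩
    ∑[ q < n ] (c q * (indicator (lookup t q) + ∑[ p < n ] (move q a p * paths M t p w)))
      ≡⟨ sum-cong-≗ (λ q → *-distribˡ-+ (c q) _ _) ⟩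
    ∑[ q < n ] (c q * indicator (lookup t q) + c q * ∑[ p < n ] (move q a p * paths M t p w))
      ≡⟨ ∑-distrib-+ (λ q → c q * indicator (lookup t q)) (λ q → c q * ∑[ p < n ] (move q a p * paths M t p w)) ⟩
    hits t c + ∑[ q < n ] (c q * ∑[ p < n ] (move q a p * paths M t p w))
      ≡⟨ cong (λ r → hits t c + r) (sum-cong-≗ λ q →
           trans (*-distribˡ-sum (c q) λ p → move q a p * paths M t p w)
                 (sum-cong-≗ λ p → ≡-sym (*-assoc (c q) (move q a p) (paths M t p w)))) ⟩
    hits t c + ∑[ q < n ] ∑[ p < n ] (c q * move q a p * paths M t p w)
      ≡⟨ cong (λ r → hits t c + r) (∑-comm λ q p → c q * move q a p * paths M t p w) ⟩
    hits t c + ∑[ p < n ] ∑[ q < n ] (c q * move q a p * paths M t p w)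
      ≡⟨ cong (λ r → hits t c + r) (sum-cong-≗ λ p → ≡-sym (*-distribʳ-sum (paths M t p w) λ q → c q * move q a p)) ⟩
    hits t c + weighted t (step c a) w ∎
    where n = states M

  run : Weights → List (Sym s) → Weights
  run c []      = c
  run c (a ∷ u) = run (step c a) u

  hitsAlong : Subset (states M) → Weights → List (Sym s) → ℕ
  hitsAlong t c []      = 0
  hitsAlong t c (a ∷ u) = hits t c + hitsAlong t (step c a) u

  weighted-++ : ∀ {t} → HaltingSet t → ∀ c u w →
    weighted t c (u ++ w) ≡ hitsAlong t c u + weighted t (run c u) w
  weighted-++     t-halting c []      w = refl
  weighted-++ {t} t-halting c (a ∷ u) w = begin
    weighted t c (a ∷ u ++ w)
      ≡⟨ weighted-∷ {t} t-halting c a (u ++ w) ⟩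
    hits t c + weighted t (step c a) (u ++ w)
      ≡⟨ cong (λ r → hits t c + r) (weighted-++ {t} t-halting (step c a) u w) ⟩
    hits t c + (hitsAlong t (step c a) u + weighted t (run (step c a) u) w)
      ≡⟨ ≡-sym (+-assoc (hits t c) _ _) ⟩
    hitsAlong t c (a ∷ u) + weighted t (run c (a ∷ u)) w ∎

  initial : Weights
  initial q = indicator (lookup ⁅ q₀ M ⁆ q)

  weighted-initial : ∀ t w → weighted t initial w ≡ paths M t (q₀ M) w
  weighted-initial t w = ∑-indicator-⁅⁆ (q₀ M) (λ q → paths M t q w)

module FiniteParity {s : ℕ} (M : 1NFA s) where
  open Paths M

  halted : List (Sym s) → ℕ
  halted w = paths M (Qacc M) (q₀ M) w + paths M (Qrej M) (q₀ M) w

  hitsBoth : List (Sym s) → ℕ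
  hitsBoth u = hitsAlong (Qacc M) initial u + hitsAlong (Qrej M) initial u

  weightedBoth : Weights → List (Sym s) → ℕ
  weightedBoth c w = weighted (Qacc M) c w + weighted (Qrej M) c w

  halted-++ : ∀ u w → halted (u ++ w) ≡ hitsBoth u + weightedBoth (run initial u) w
  halted-++ u w = begin
    halted (u ++ w)
      ≡⟨ ≡-sym (cong₂ _+_ (weighted-initial (Qacc M) (u ++ w)) (weighted-initial (Qrej M) (u ++ w))) ⟩
    weighted (Qacc M) initial (u ++ w) + weighted (Qrej M) initial (u ++ w)
      ≡⟨ cong₂ _+_ (weighted-++ {Qacc M} Qacc-halting initial u w) (weighted-++ {Qrej M} Qrej-halting initial u w) ⟩
    (hitsAlong (Qacc M) initial u + weighted (Qacc M) (run initial u) w) +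
    (hitsAlong (Qrej M) initial u + weighted (Qrej M) (run initial u) w)
      ≡⟨ interchange (hitsAlong (Qacc M) initial u) _ (hitsAlong (Qrej M) initial u) _ ⟩
    hitsBoth u + weightedBoth (run initial u) w ∎

  signature : List (Sym s) → Fin (suc (states M)) → Fin 2
  signature u zero    = hitsBoth u mod 2
  signature u (suc q) = run initial u q mod 2

  signature-determines-parity : ∀ u u′ → signature u ≗ signature u′ →
    ∀ w → halted (u ++ w) ≡ₘ halted (u′ ++ w)
  signature-determines-parity u u′ same w rewrite halted-++ u w | halted-++ u′ w =
    +-cong (mod-injective {hitsBoth u} {hitsBoth u′} (same zero))
           (+-cong (weighted-cong (Qacc M)) (weighted-cong (Qrej M)))
    where
    weighted-cong : ∀ t → weighted t (run initial u) w ≡ₘ weighted t (run initial u′) w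
    weighted-cong t = sum-cong λ q →
      *-congʳ (paths M t q w) (mod-injective {run initial u q} {run initial u′ q} (same (suc q)))

  parity-collision : (u : ℕ → List (Sym s)) →
    Σ ℕ λ i → Σ ℕ λ j → i < j × (∀ w → halted (u i ++ w) ≡ₘ halted (u j ++ w))
  parity-collision u
    with i , j , i<j , same ← pigeonhole (n<1+n (2 ^ suc (states M))) (λ i → funToFin (signature (u (toℕ i))))
    = toℕ i , toℕ j , i<j , signature-determines-parity (u (toℕ i)) (u (toℕ j)) λ q →
        trans (≡-sym (finToFun-funToFin (signature (u (toℕ i))) q))
          (trans (cong (λ c → finToFun c q) same) (finToFun-funToFin (signature (u (toℕ j))) q))

#halted : ∀ {s} → 1NFA s → List (Fin s) → ℕ
#halted M x = #acc M x + #rej M x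

tape-++ : ∀ {s} (x v : List (Fin s)) → tape (x ++ v) ≡ (▷ ∷ map sym x) ++ (map sym v ++ ◁ ∷ [])
tape-++ x v = cong (▷ ∷_) (trans (cong (_++ ◁ ∷ []) (map-++ sym x v)) (++-assoc (map sym x) (map sym v) (◁ ∷ [])))

#halted-collision : ∀ {s} (M : 1NFA s) (u : ℕ → List (Fin s)) →
  Σ ℕ λ i → Σ ℕ λ j → i < j × (∀ v → #halted M (u i ++ v) ≡ₘ #halted M (u j ++ v))
#halted-collision M u with i , j , i<j , same ← FiniteParity.parity-collision M (λ i → ▷ ∷ map sym (u i)) =
  i , j , i<j , λ v → subst₂ _≡ₘ_ (cong halted (≡-sym (tape-++ (u i) v))) (cong halted (≡-sym (tape-++ (u j) v)))
                                 (same (map sym v ++ ◁ ∷ []))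
  where halted = FiniteParity.halted M

m-n≡k⇒m≡k+n : ∀ {m n k} → + m - + n ≡ + k → m ≡ k + n
m-n≡k⇒m≡k+n {m} {n} {k} eq = ℤ.+-injective (begin
  + m                    ≡⟨ ℤ.+-identityʳ (+ m) ⟨
  + m +ℤ 0ℤ              ≡⟨ cong (+ m +ℤ_) (ℤ.+-inverseˡ (+ n)) ⟨
  + m +ℤ (- + n +ℤ + n)  ≡⟨ ℤ.+-assoc (+ m) (- + n) (+ n) ⟨
  + m - + n +ℤ + n       ≡⟨ cong (_+ℤ + n) eq ⟩
  + (k + n)              ∎)

gap-parity : ∀ {s} (M : 1NFA s) x {g} → gap M x ≡ + g → #halted M x ≡ₘ g
gap-parity M x {g} eq = mod-≡ (begin
  (#acc M x + r) % 2     ≡⟨ cong (λ a → (a + r) % 2) (m-n≡k⇒m≡k+n eq) ⟩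
  (g + r + r) % 2        ≡⟨ cong (_% 2) (+-assoc g r r) ⟩
  (g + (r + r)) % 2      ≡⟨ cong (λ y → (g + y) % 2) r+r≡r*2 ⟩
  (g + r * 2) % 2        ≡⟨ [m+kn]%n≡m%n g r 2 ⟩
  g % 2                  ∎)
  where
  r = #rej M x
  r+r≡r*2 : r + r ≡ r * 2
  r+r≡r*2 = ≡-sym (trans (*-comm r 2) (cong (λ y → r + y) (+-identityʳ r)))

Separated : ∀ {s} → Promise s → ℕ → List (Fin s) → List (Fin s) → Set
Separated L n x y = (pos L n x × neg L n y) ⊎ (neg L n x × pos L n y)

1SP⇒parity : ∀ {s} {L : Promise s} → In1SP L → ∀ n → Σ (1NFA s) λ M →
  (∀ x → pos L n x → #halted M x ≡ₘ 1) × (∀ x → neg L n x → #halted M x ≡ₘ 0)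
1SP⇒parity (F , (M , _ , f≡gap) , sub⁺ , sub⁻ , f≡1 , f≡0) n =
  M n ,
  (λ x x⁺ → gap-parity (M n) x (trans (≡-sym (f≡gap n x (sub⁺ n x x⁺))) (f≡1 n x x⁺))) ,
  (λ x x⁻ → gap-parity (M n) x (trans (≡-sym (f≡gap n x (sub⁻ n x x⁻))) (f≡0 n x x⁻)))

fooling⇒¬1SP : ∀ {s} (L : Promise s) n (u : ℕ → List (Fin s)) →
  (∀ {i j} → i < j → Σ (List (Fin s)) λ v → Separated L n (u i ++ v) (u j ++ v)) → ¬ In1SP L
fooling⇒¬1SP L n u fooling L∈1SP
  with M , odd-on-pos , even-on-neg ← 1SP⇒parity {L = L} L∈1SP n
  with i , j , i<j , same ← #halted-collision M u
  with fooling i<j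
... | v , inj₁ (x⁺ , y⁻) =
  contradiction (trans (≡-sym (%-≡ (odd-on-pos _ x⁺))) (trans (%-≡ (same v)) (%-≡ (even-on-neg _ y⁻)))) λ ()
... | v , inj₂ (x⁻ , y⁺) =
  contradiction (trans (≡-sym (%-≡ (even-on-neg _ x⁻))) (trans (%-≡ (same v)) (%-≡ (odd-on-pos _ y⁺)))) λ ()

aⁱbʲ : ℕ → ℕ → List (Fin 2)
aⁱbʲ i j = replicate i zero ++ replicate j (suc zero)

counterδ : Fin 3 → Sym 2 → Subset 3
counterδ zero          ▷                = ⁅ zero ⁆
counterδ zero          (sym zero)       = true ∷ true ∷ false ∷ []
counterδ zero          (sym (suc zero)) = true ∷ false ∷ true ∷ []
counterδ zero          ◁                = ∅
counterδ (suc _)       _                = ∅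

-- State 0 scans the input; every a spawns an accepting path, every b a rejecting one.
counter : 1NFA 2
counter = record
  { states   = 3
  ; δ        = counterδ
  ; q₀       = zero
  ; Qacc     = false ∷ true ∷ false ∷ []
  ; Qrej     = false ∷ false ∷ true ∷ []
  ; disjoint = λ { zero () _ ; (suc zero) _ () ; (suc (suc zero)) () _ }
  }

counter-acc : ∀ i j → paths counter (Qacc counter) zero (map sym (aⁱbʲ i j) ++ ◁ ∷ []) ≡ i
counter-acc zero    zero    = refl
counter-acc zero    (suc j) = trans (+-identityʳ _) (counter-acc zero j)
counter-acc (suc i) j       = trans (+-comm _ 1) (cong suc (counter-acc i j))

counter-rej : ∀ i j → paths counter (Qrej counter) zero (map sym (aⁱbʲ i j) ++ ◁ ∷ []) ≡ j
counter-rej zero    zero    = refl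
counter-rej zero    (suc j) = trans (+-comm _ 1) (cong suc (counter-rej zero j))
counter-rej (suc i) j       = trans (+-identityʳ _) (counter-rej i j)

counter-gap : ∀ i j → gap counter (aⁱbʲ i j) ≡ + i - + j
counter-gap i j = cong₂ (λ m n → + m - + n)
  (trans (+-identityʳ _) (counter-acc i j)) (trans (+-identityʳ _) (counter-rej i j))

counter-gap-diagonal : ∀ i → gap counter (aⁱbʲ i i) ≡ + 0
counter-gap-diagonal i = trans (counter-gap i i) (ℤ.+-inverseʳ (+ i))

counter-gap≡0⇒diagonal : ∀ i j → gap counter (aⁱbʲ i j) ≡ + 0 → i ≡ j
counter-gap≡0⇒diagonal i j eq = m-n≡k⇒m≡k+n (trans (≡-sym (counter-gap i j)) eq)

equalAB : Promise 2
equalAB = record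
  { pos  = λ _ x → Σ ℕ λ i → x ≡ aⁱbʲ i i
  ; neg  = λ _ x → Σ ℕ λ i → Σ ℕ λ j → i ≢ j × x ≡ aⁱbʲ i j
  ; disj = λ { _ _ (i , refl) (i′ , j , i′≢j , eq) →
      i′≢j (counter-gap≡0⇒diagonal i′ j (trans (cong (gap counter) (≡-sym eq)) (counter-gap-diagonal i))) }
  }

counterFamily : PFam 2
counterFamily = record { D = λ _ _ → ⊤ ; f = λ _ x _ → gap counter x }

counterFamily∈1Gap : In1Gap counterFamily
counterFamily∈1Gap = (λ _ → counter) , (3 ∷ [] , λ n → m≤m+n 3 (n * 0)) , λ _ _ _ → refl

equalAB∈1C₌ : In1C₌ equalAB
equalAB∈1C₌ =
  counterFamily , counterFamily∈1Gap , (λ _ _ _ → tt) , (λ _ _ _ → tt) ,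
  (λ { _ _ (i , refl) → counter-gap-diagonal i }) ,
  (λ { _ _ (i , j , i≢j , refl) → i≢j ∘ counter-gap≡0⇒diagonal i j })

equalAB∉1SP : ¬ In1SP equalAB
equalAB∉1SP = fooling⇒¬1SP equalAB 0 (λ i → replicate i zero) λ {i} {j} i<j →
  replicate i (suc zero) , inj₁ ((i , refl) , (j , i , ≢-sym (<⇒≢ i<j) , refl))

co-equalAB∉1SP : ¬ In1SP (co equalAB)
co-equalAB∉1SP = fooling⇒¬1SP (co equalAB) 0 (λ i → replicate i zero) λ {i} {j} i<j →
  replicate i (suc zero) , inj₂ ((i , refl) , (j , i , ≢-sym (<⇒≢ i<j) , refl))

1SP⊆co-1C₌ : ∀ {s} (L : Promise s) → In1SP L → InCo1C₌ L
1SP⊆co-1C₌ L (F , F∈1Gap , sub⁺ , sub⁻ , f≡1 , f≡0) =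
  F , F∈1Gap , sub⁻ , sub⁺ , f≡0 , λ n x x⁺ f≡0′ → contradiction (trans (≡-sym (f≡1 n x x⁺)) f≡0′) λ ()

-- A fresh start state forks into a new rejecting state and into whatever q₀ does on the first
-- symbol (q₀ itself if it is already halting), so exactly one rejecting path is added.
module ExtraRejection {s : ℕ} (M : 1NFA s) where

  open Paths M using (HaltingSet; Qacc-halting; Qrej-halting; paths-halting)

  firstMove : Sym s → Subset (states M)
  firstMove a = if halting M (q₀ M) then ⁅ q₀ M ⁆ else δ M (q₀ M) a

  extendedδ : Fin (2 + states M) → Sym s → Subset (2 + states M)
  extendedδ zero          a = false ∷ true ∷ firstMove a
  extendedδ (suc zero)    a = ∅
  extendedδ (suc (suc q)) a = false ∷ false ∷ δ M q a

  M⁺ : 1NFA s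
  M⁺ = record
    { states   = 2 + states M
    ; δ        = extendedδ
    ; q₀       = zero
    ; Qacc     = false ∷ false ∷ Qacc M
    ; Qrej     = false ∷ true ∷ Qrej M
    ; disjoint = λ { zero () _ ; (suc zero) () _ ; (suc (suc q)) → disjoint M q }
    }

  paths-shifted : ∀ b₀ b₁ t q w → paths M⁺ (b₀ ∷ b₁ ∷ t) (suc (suc q)) w ≡ paths M t q w
  paths-shifted b₀ b₁ t q []      with lookup t q | halting M q
  ... | true  | _     = refl
  ... | false | true  = refl
  ... | false | false = refl
  paths-shifted b₀ b₁ t q (a ∷ w) with lookup t q | halting M q
  ... | true  | _     = refl
  ... | false | true  = refl
  ... | false | false = begin
    List.sum (map (masked (extendedδ (suc (suc q)) a) λ p → paths M⁺ t⁺ p w) (allFin _))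
      ≡⟨ sum-map-allFin (2 + states M) (masked (extendedδ (suc (suc q)) a) λ p → paths M⁺ t⁺ p w) ⟩
    sum (masked (δ M q a) λ p → paths M⁺ t⁺ (suc (suc p)) w)
      ≡⟨ sum-cong-≗ (λ p → cong (λ n → if lookup (δ M q a) p then n else 0) (paths-shifted b₀ b₁ t p w)) ⟩
    sum (masked (δ M q a) λ p → paths M t p w)
      ≡⟨ sum-map-allFin (states M) (masked (δ M q a) λ p → paths M t p w) ⟨
    List.sum (map (masked (δ M q a) λ p → paths M t p w) (allFin _)) ∎
    where t⁺ = b₀ ∷ b₁ ∷ t

  ∑-⁅q₀⁆ : halting M (q₀ M) ≡ true → ∀ t w →
    sum (masked ⁅ q₀ M ⁆ λ p → paths M t p w) ≡ indicator (lookup t (q₀ M))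
  ∑-⁅q₀⁆ h t w = begin
    sum (masked ⁅ q₀ M ⁆ λ p → paths M t p w)
      ≡⟨ sum-cong-≗ (masked≡indicator* ⁅ q₀ M ⁆ λ p → paths M t p w) ⟩
    ∑[ p < states M ] (indicator (lookup ⁅ q₀ M ⁆ p) * paths M t p w)
      ≡⟨ ∑-indicator-⁅⁆ (q₀ M) (λ p → paths M t p w) ⟩
    paths M t (q₀ M) w
      ≡⟨ paths-halting t (q₀ M) w h ⟩
    indicator (lookup t (q₀ M)) ∎

  paths-firstMove : ∀ {t} → HaltingSet t → ∀ a w →
    sum (masked (firstMove a) λ p → paths M t p w) ≡ paths M t (q₀ M) (a ∷ w)
  paths-firstMove {t} t-halting a w with lookup t (q₀ M) in q₀∈t | halting M (q₀ M) in h
  ... | true  | true  = trans (∑-⁅q₀⁆ h t w) (cong indicator q₀∈t)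
  ... | false | true  = trans (∑-⁅q₀⁆ h t w) (cong indicator q₀∈t)
  ... | true  | false = contradiction (trans (≡-sym h) (t-halting (q₀ M) q₀∈t)) λ ()
  ... | false | false = ≡-sym (sum-map-allFin (states M) (masked (δ M (q₀ M) a) λ p → paths M t p w))

  paths-rejecting : ∀ b t w → paths M⁺ (false ∷ b ∷ t) (suc zero) w ≡ indicator b
  paths-rejecting true  t w = refl
  paths-rejecting false t w = refl

  paths-start : ∀ b {t} → HaltingSet t → ∀ a w →
    paths M⁺ (false ∷ b ∷ t) zero (a ∷ w) ≡ indicator b + paths M t (q₀ M) (a ∷ w)
  paths-start b {t} t-halting a w = begin
    paths M⁺ t⁺ zero (a ∷ w)
      ≡⟨ sum-map-allFin (2 + states M) (masked (extendedδ zero a) λ p → paths M⁺ t⁺ p w) ⟩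
    paths M⁺ t⁺ (suc zero) w + sum (masked (firstMove a) λ p → paths M⁺ t⁺ (suc (suc p)) w)
      ≡⟨ cong₂ _+_ (paths-rejecting b t w)
           (sum-cong-≗ λ p → cong (λ n → if lookup (firstMove a) p then n else 0) (paths-shifted false b t p w)) ⟩
    indicator b + sum (masked (firstMove a) λ p → paths M t p w)
      ≡⟨ cong (λ n → indicator b + n) (paths-firstMove {t} t-halting a w) ⟩
    indicator b + paths M t (q₀ M) (a ∷ w) ∎
    where t⁺ = false ∷ b ∷ t

  gap-M⁺ : ∀ x → gap M⁺ x ≡ gap M x - + 1
  gap-M⁺ x = begin
    + #acc M⁺ x - + #rej M⁺ x
      ≡⟨ cong₂ (λ m n → + m - + n) (paths-start false (Qacc-halting) ▷ w) (paths-start true (Qrej-halting) ▷ w) ⟩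
    + a - + (1 + r)
      ≡⟨ cong (λ n → + a - + n) (+-comm 1 r) ⟩
    + a +ℤ - (+ r +ℤ + 1)
      ≡⟨ cong (+ a +ℤ_) (ℤ.neg-distrib-+ (+ r) (+ 1)) ⟩
    + a +ℤ (- + r +ℤ - + 1)
      ≡⟨ ℤ.+-assoc (+ a) (- + r) (- + 1) ⟨
    + a - + r - + 1 ∎
    where
    w = map sym x ++ ◁ ∷ []
    a = #acc M x
    r = #rej M x

addConstant : ℕ → Poly → Poly
addConstant c []       = c ∷ []
addConstant c (c₀ ∷ p) = c + c₀ ∷ p

eval-addConstant : ∀ c p n → eval (addConstant c p) n ≡ c + eval p n
eval-addConstant c []       n = cong (λ m → c + m) (*-zeroʳ n)
eval-addConstant c (c₀ ∷ p) n = +-assoc c c₀ (n * eval p n)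

1Gap-minus-one : ∀ {s} {F : PFam s} → In1Gap F →
  In1Gap (record { D = D F ; f = λ n x d → f F n x d - + 1 })
1Gap-minus-one {F = F} (M , (p , size) , f≡gap) =
  (λ n → ExtraRejection.M⁺ (M n)) ,
  (addConstant 2 p , λ n → subst (2 + states (M n) ≤_) (≡-sym (eval-addConstant 2 p n)) (s≤s (s≤s (size n)))) ,
  λ n x d → trans (cong (_- + 1) (f≡gap n x d)) (≡-sym (ExtraRejection.gap-M⁺ (M n) x))

1SP⊆1C₌ : ∀ {s} (L : Promise s) → In1SP L → In1C₌ L
1SP⊆1C₌ L (F , F∈1Gap , sub⁺ , sub⁻ , f≡1 , f≡0) =
  _ , 1Gap-minus-one {F = F} F∈1Gap , sub⁺ , sub⁻ ,
  (λ n x x⁺ → cong (_- + 1) (f≡1 n x x⁺)) ,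
  (λ n x x⁻ eq → contradiction (trans (≡-sym (cong (_- + 1) (f≡0 n x x⁻))) eq) λ ())

proposition4p8 :
  ((s : ℕ) (L : Promise s) → In1SP L → InCo1C₌ L) ×
  (Σ ℕ λ s → Σ (Promise s) λ L → InCo1C₌ L × ¬ In1SP L) ×
  ((s : ℕ) (L : Promise s) → In1SP L → In1C₌ L) ×
  (Σ ℕ λ s → Σ (Promise s) λ L → In1C₌ L × ¬ In1SP L)
proposition4p8 =
  (λ _ → 1SP⊆co-1C₌) ,
  (2 , co equalAB , equalAB∈1C₌ , co-equalAB∉1SP) ,
  (λ _ → 1SP⊆1C₌) ,
  (2 , equalAB , equalAB∈1C₌ , equalAB∉1SP)
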